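{- Let $(T,\beta,g)$ be a guarded cutvertex decomposition of a colored graph $H$ with guard size at most $c$ and with bags having at most $c$ colors. If $|\lambda(t)|\ge k$ for some $t\in V(T)$, then $H$ contains a half-colorful matching with at least $k/c^2-1$ edges.
   Context: A colored graph is a finite simple graph with a (not necessarily proper) vertex coloring. $H^{\bullet}$ is obtained from $H$ by making each color class a clique. For a rooted tree decomposition $(T,\beta)$: $\sigma(t)=\beta(t)\cap\beta(\text{parent}(t))$, $\sigma(\text{root})=\emptyset$, $\gamma(t)$ is the union of bags of $t$ and its descendants, $\alpha(t)=\gamma(t)\setminus\sigma(t)$. A guarded cutvertex decomposition of $H$ is $(T,\beta,g)$ with $(T,\beta)$ a rooted tree decomposition of $H^{\bullet}$ and $\sigma(t)\subseteq g(t)\subseteq\beta(t)$, such that $g(t)$ is a vertex cover of $H[\beta(t)]$ for all $t$ and $|\sigma(t')\setminus g(t)|\le1$ for every child $t'$ of $t$; guard size is $\max_t|g(t)|$. For $v\in\beta(t)\setminus g(t)$, $h_t(v)$ is the set of children $t'$ of $t$ with $v$ adjacent to a vertex of $\alpha(t')$; $\lambda(t)=\{v\in\beta(t)\setminus g(t):h_t(v)\ne\emptyset\}$. A half-colorful matching in $H$ is a matching $x_1y_1,\dots,x_my_m$ (a subgraph of $H$) such that all $x_i$ lie in one color class $C_0$ and $y_1,\dots,y_m$ lie in pairwise distinct color classes different from $C_0$; its size is $m$. -}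

module Defs where

open import Data.Nat using (ℕ; zero; suc; _≤_; _+_; _*_)
open import Data.Fin using (Fin; zero; suc; toℕ)
open import Data.Fin.Subset using (Subset; _∈_; _∉_; _⊆_; _∩_; _─_; ∣_∣; ⊥)
open import Data.Product using (Σ; ∃; _×_; _,_)
open import Data.Sum using (_⊎_)
open import Relation.Binary.PropositionalEquality using (_≡_; _≢_)
open import Relation.Nullary using (¬_)
open import Relation.Binary using (Decidable)
open import Function.Definitions using (Injective)

record ColoredGraph : Set₁ where
  field
    n     : ℕ
    Adj   : Fin n → Fin n → Set
    adj?  : Decidable Adj
    sym   : ∀ {u v} → Adj u v → Adj v u
    irr   : ∀ {v} → ¬ Adj v v
    col   : Fin n → ℕ

-- H• : each color class made into a clique
module _ (H : ColoredGraph) where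
  open ColoredGraph H
  AdjDot : Fin n → Fin n → Set
  AdjDot u v = Adj u v ⊎ (u ≢ v × col u ≡ col v)

-- Rooted trees.  Nodes are Fin (suc m); the root is zero; the node
-- suc i has parent  par i,  whose index is smaller (every finite rooted
-- tree admits such a labelling).

record RootedTree : Set where
  field
    m      : ℕ
    par    : Fin m → Fin (suc m)
    par<   : ∀ i → toℕ (par i) ≤ toℕ i

  Node : Set
  Node = Fin (suc m)

  root : Node
  root = zero

  ChildOf : Fin m → Node → Set
  ChildOf i t = par i ≡ t

  TAdj : Node → Node → Set
  TAdj a b = (Σ (Fin m) λ i → a ≡ suc i × b ≡ par i)
           ⊎ (Σ (Fin m) λ i → b ≡ suc i × a ≡ par i)

  data Desc : Node → Node → Set where
    here : ∀ {t} → Desc t t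
    up   : ∀ {i t} → Desc (par i) t → Desc (suc i) t

  data WalkIn (P : Node → Set) : Node → Node → Set where
    stop : ∀ {a} → P a → WalkIn P a a
    step : ∀ {a b c} → P a → TAdj a b → WalkIn P b c → WalkIn P a c

  ConnectedSet : (Node → Set) → Set
  ConnectedSet P = ∀ a b → P a → P b → WalkIn P a b

record RootedTD (n : ℕ) (E : Fin n → Fin n → Set) : Set₁ where
  field
    T    : RootedTree
  open RootedTree T public
  field
    β         : Node → Subset n
    covers-v  : ∀ v → Σ Node λ t → v ∈ β t
    covers-e  : ∀ u v → E u v → Σ Node λ t → u ∈ β t × v ∈ β t
    connected : ∀ v → ConnectedSet (λ t → v ∈ β t)

  σ : Node → Subset n
  σ zero    = ⊥
  σ (suc i) = β (suc i) ∩ β (par i)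

  _∈γ_ : Fin n → Node → Set
  v ∈γ t = Σ Node λ s → Desc s t × v ∈ β s

  _∈α_ : Fin n → Node → Set
  v ∈α t = v ∈γ t × v ∉ σ t

record GuardedCutvertexDecomposition (H : ColoredGraph) : Set₁ where
  open ColoredGraph H
  field
    TD : RootedTD n (AdjDot H)
  open RootedTD TD public
  field
    g          : Node → Subset n
    σ⊆g        : ∀ t → σ t ⊆ g t
    g⊆β        : ∀ t → g t ⊆ β t
    vertexCover : ∀ t u v → u ∈ β t → v ∈ β t → Adj u v → u ∈ g t ⊎ v ∈ g t
    childCond  : ∀ t (i : Fin m) → ChildOf i t → ∣ σ (suc i) ─ g t ∣ ≤ 1

  -- h_t(v) ≠ ∅ ; λ(t) membership
  _∈λ_ : Fin n → Node → Set
  v ∈λ t = v ∈ β t × v ∉ g t ×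
           (Σ (Fin m) λ i → ChildOf i t × (Σ (Fin n) λ u → u ∈α (suc i) × Adj v u))

  GuardSize≤ : ℕ → Set
  GuardSize≤ c = ∀ t → ∣ g t ∣ ≤ c

  BagColors≤ : ℕ → Set
  BagColors≤ c = ∀ t → Σ (Fin c → ℕ) λ cs →
                   ∀ v → v ∈ β t → Σ (Fin c) λ j → col v ≡ cs j

AtLeast : ∀ {n} → ℕ → (Fin n → Set) → Set
AtLeast {n} k P = Σ (Fin k → Fin n) λ f → Injective _≡_ _≡_ f × (∀ j → P (f j))

record HalfColorfulMatching (H : ColoredGraph) (s : ℕ) : Set where
  open ColoredGraph H
  field
    x y     : Fin s → Fin n
    edge    : ∀ i → Adj (x i) (y i)
    x-inj   : Injective _≡_ _≡_ x
    y-inj   : Injective _≡_ _≡_ y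
    xy-disj : ∀ i j → x i ≢ y j
    C₀      : ℕ
    x-col   : ∀ i → col (x i) ≡ C₀
    y-col   : ∀ i → col (y i) ≢ C₀
    y-colorful : Injective _≡_ _≡_ (λ i → col (y i))

-- Every v ∈ λ(t) comes with a child t' = suc i of t and a neighbour u of v
-- in α(t').  Because adhesions separate a subtree from the rest of the
-- tree (every walk of bags containing u that leaves the subtree of t' uses
-- the edge t't), α(t') only meets bags below t'.  Hence v ∈ σ(t') ∖ g(t),
-- and the child condition |σ(t') ∖ g(t)| ≤ 1 makes v ↦ t' injective; the
-- partners u of different λ-vertices lie below different siblings, so they
-- share no bag and (as colour classes are cliques of H•) have distinct
-- colours; and a partner's colour never equals the colour of another
-- λ-vertex.  Such a family of edges v u is a "matching candidate family":
-- any monochromatic subfamily of the v's of size ≥ 2 is a half-colourful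
-- matching.  The bag of t has at most c colours, so a pigeonhole argument
-- finds a monochromatic subfamily of size M ≥ k / c, and k ≤ c·M ≤ (1+s)c².
module Submission where

open import Defs
open import Data.Nat using (ℕ; zero; suc; _≤_; _<_; _*_; _+_; z≤n; s≤s⁻¹; _≟_)
open import Data.Nat.Properties
  using (≤-refl; ≤-trans; ≤∧≢⇒<; <⇒≤; ≰⇒>; <⇒≱; n≤1+n; 1+n≰n; m≤m*n;
         +-suc; +-monoʳ-≤; +-monoˡ-≤; *-monoʳ-≤; *-monoˡ-≤; *-comm; _≤?_; module ≤-Reasoning)
open import Data.Fin using (Fin; zero; suc; toℕ)
open import Data.Fin.Properties using (toℕ-injective; toℕ<n; ¬Fin0) renaming (_≟_ to _≟ᶠ_)
open import Data.Fin.Subset using (Subset; _∈_; _∉_; _⊆_; _─_; ∣_∣; ⁅_⁆)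
open import Data.Fin.Subset.Properties
  using (_∈?_; x∈p∩q⁺; x∈p∧x∉q⇒x∈p─q; x∈⁅y⁆⇒x≡y; ∣⁅x⁆∣≡1; p⊂q⇒∣p∣<∣q∣)
open import Data.List using (List; []; _∷_; length; lookup; filter; allFin)
open import Data.List.Properties using (length-tabulate)
open import Data.List.Membership.Propositional.Properties using (∈-lookup)
open import Data.List.Relation.Unary.All as All using (All; []; universal)
open import Data.List.Relation.Unary.All.Properties using (all-filter) renaming (filter⁺ to All-filter⁺)
open import Data.List.Relation.Unary.AllPairs using (_∷_)
open import Data.List.Relation.Unary.Unique.Propositional using (Unique)
open import Data.List.Relation.Unary.Unique.Propositional.Properties
  using (allFin⁺) renaming (filter⁺ to Unique-filter⁺)
open import Data.List.Relation.Binary.Sublist.Propositional using () renaming (_⊆_ to _⊑_)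
open import Data.List.Relation.Binary.Sublist.Propositional.Properties
  using (filter-⊆; length-mono-≤) renaming (filter⁺ to Sublist-filter⁺)
open import Data.Product using (Σ; _×_; _,_; proj₁; proj₂)
open import Data.Sum using (_⊎_; inj₁; inj₂)
open import Data.Empty using (⊥)
open import Data.Bool using (true; false)
open import Relation.Nullary using (¬_; Dec; does; yes; no; contradiction; ¬?)
open import Relation.Nullary.Decidable using (decidable-stable)
open import Relation.Binary.PropositionalEquality using (_≡_; _≢_; refl; sym; trans; cong; subst)
open import Function using (_∘_; id)
open import Function.Definitions using (Injective)

filter-split : ∀ {A : Set} {P : A → Set} (P? : ∀ x → Dec (P x)) xs →
               length (filter P? xs) + length (filter (λ x → ¬? (P? x)) xs) ≡ length xs
filter-split P? [] = refl
filter-split P? (x ∷ xs) with does (P? x)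
... | true  = cong suc (filter-split P? xs)
... | false = trans (+-suc _ _) (cong suc (filter-split P? xs))

module Pigeonhole {A : Set} (κ : A → ℕ) where

  fiber coFiber : ℕ → List A → List A
  fiber a = filter (λ x → κ x ≟ a)
  coFiber a = filter (λ x → ¬? (κ x ≟ a))

  fiber-split : ∀ a xs → length (fiber a xs) + length (coFiber a xs) ≡ length xs
  fiber-split a = filter-split (λ x → κ x ≟ a)

  fiber-mono : ∀ a {xs ys} → xs ⊑ ys → length (fiber a xs) ≤ length (fiber a ys)
  fiber-mono a xs⊑ys =
    length-mono-≤ (Sublist-filter⁺ (λ x → κ x ≟ a) (λ x → κ x ≟ a) (λ { refl → id }) xs⊑ys)

  coFiber-below : ∀ c {xs} → All (λ x → κ x < suc c) xs → All (λ x → κ x < c) (coFiber c xs)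
  coFiber-below c {xs} κ<1+c =
    All.zipWith (λ (κx<1+c , κx≢c) → ≤∧≢⇒< (s≤s⁻¹ κx<1+c) κx≢c)
                (All-filter⁺ _ κ<1+c , all-filter _ xs)

  top-and-rest : ∀ c a xs → length (coFiber c xs) ≤ c * length (fiber a (coFiber c xs)) →
                 length xs ≤ length (fiber c xs) + c * length (fiber a (coFiber c xs))
  top-and-rest c a xs rest≤ = begin
    length xs                            ≡⟨ sym (fiber-split c xs) ⟩
    length (fiber c xs) + length (coFiber c xs)
                                         ≤⟨ +-monoʳ-≤ (length (fiber c xs)) rest≤ ⟩
    length (fiber c xs) + c * length (fiber a (coFiber c xs)) ∎
    where open ≤-Reasoning

  pigeonhole : ∀ c xs → All (λ x → κ x < c) xs → Σ ℕ λ a → length xs ≤ c * length (fiber a xs)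
  pigeonhole zero [] [] = 0 , z≤n
  pigeonhole (suc c) xs κ<1+c with pigeonhole c (coFiber c xs) (coFiber-below c κ<1+c)
  ... | a , rest≤ with length (fiber a (coFiber c xs)) ≤? length (fiber c xs)
  ... | yes rest≤top =
    c , ≤-trans (top-and-rest c a xs rest≤) (+-monoʳ-≤ (length (fiber c xs)) (*-monoʳ-≤ c rest≤top))
  ... | no rest≰top =
    a , ≤-trans (top-and-rest c a xs rest≤)
          (≤-trans (+-monoˡ-≤ _ (<⇒≤ (≰⇒> rest≰top)))
                   (*-monoʳ-≤ (suc c) (fiber-mono a (filter-⊆ _ xs))))

lookup-injective : ∀ {A : Set} {xs : List A} → Unique xs →
                   ∀ {i j} → lookup xs i ≡ lookup xs j → i ≡ j
lookup-injective (_    ∷ _) {zero}  {zero}  _  = refl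
lookup-injective (x∉xs ∷ _) {zero}  {suc j} eq = contradiction eq (All.lookup x∉xs (∈-lookup j))
lookup-injective (x∉xs ∷ _) {suc i} {zero}  eq = contradiction (sym eq) (All.lookup x∉xs (∈-lookup i))
lookup-injective (_ ∷ xs-unique) {suc i} {suc j} eq = cong suc (lookup-injective xs-unique eq)

monochromatic-subfamily : ∀ {k c} (κ : Fin k → Fin c) →
  Σ ℕ λ M → Σ (Fin M → Fin k) λ e →
    Injective _≡_ _≡_ e × (∀ i i' → κ (e i) ≡ κ (e i')) × k ≤ c * M
monochromatic-subfamily {k} {c} κ =
  length members , lookup members , lookup-injective (Unique-filter⁺ _ (allFin⁺ k)) ,
  same-colour , k≤c*M
  where
  open Pigeonhole (toℕ ∘ κ)
  largest-class : Σ ℕ λ a → length (allFin k) ≤ c * length (fiber a (allFin k))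
  largest-class = pigeonhole c (allFin k) (universal (λ j → toℕ<n (κ j)) (allFin k))
  members : List (Fin k)
  members = fiber (proj₁ largest-class) (allFin k)
  member-colour : ∀ i → toℕ (κ (lookup members i)) ≡ proj₁ largest-class
  member-colour i = All.lookup (all-filter _ (allFin k)) (∈-lookup i)
  same-colour : ∀ i i' → κ (lookup members i) ≡ κ (lookup members i')
  same-colour i i' = toℕ-injective (trans (member-colour i) (sym (member-colour i')))
  k≤c*M : k ≤ c * length members
  k≤c*M = subst (_≤ c * length members) (length-tabulate id) (proj₂ largest-class)

scaled-bound : ∀ c {m} s → m ≤ suc s → c * m ≤ suc s * (c * c)
scaled-bound zero s _ = z≤n
scaled-bound c@(suc _) {m} s m≤1+s = begin
  c * m           ≤⟨ *-monoʳ-≤ c m≤1+s ⟩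
  c * suc s       ≤⟨ *-monoˡ-≤ (suc s) (m≤m*n c c) ⟩
  c * c * suc s   ≡⟨ *-comm (c * c) (suc s) ⟩
  suc s * (c * c) ∎
  where open ≤-Reasoning

≤1-members-equal : ∀ {n} {p : Subset n} {x y} → ∣ p ∣ ≤ 1 → x ∈ p → y ∈ p → x ≡ y
≤1-members-equal {p = p} {x} {y} ∣p∣≤1 x∈p y∈p with x ≟ᶠ y
... | yes x≡y = x≡y
... | no x≢y  = contradiction ∣p∣≤1 (<⇒≱ 1<∣p∣)
  where
  ⁅x⁆⊆p : ⁅ x ⁆ ⊆ p
  ⁅x⁆⊆p z∈⁅x⁆ = subst (_∈ p) (sym (x∈⁅y⁆⇒x≡y x z∈⁅x⁆)) x∈p
  y∉⁅x⁆ : y ∉ ⁅ x ⁆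
  y∉⁅x⁆ = x≢y ∘ sym ∘ x∈⁅y⁆⇒x≡y x
  1<∣p∣ : 1 < ∣ p ∣
  1<∣p∣ = subst (_< ∣ p ∣) (∣⁅x⁆∣≡1 x) (p⊂q⇒∣p∣<∣q∣ (⁅x⁆⊆p , y , y∈p , y∉⁅x⁆))

module MatchingCandidates (H : ColoredGraph) where
  open ColoredGraph H using (n; Adj; col)

  -- A family of edges x_j y_j whose monochromatic subfamilies (in the x's)
  -- of size at least two are half-colourful matchings.
  record Candidates (k : ℕ) : Set where
    field
      x y        : Fin k → Fin n
      edge       : ∀ j → Adj (x j) (y j)
      x-inj      : Injective _≡_ _≡_ x
      y-colorful : Injective _≡_ _≡_ (λ j → col (y j))
      xy-disj    : ∀ j l → x j ≢ y l
      y-avoids-x : ∀ {j l} → j ≢ l → col (y j) ≢ col (x l)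

  emptyMatching : HalfColorfulMatching H 0
  emptyMatching = record
    { x = λ () ; y = λ () ; edge = λ () ; x-inj = λ {i} → contradiction i ¬Fin0
    ; y-inj = λ {i} → contradiction i ¬Fin0 ; xy-disj = λ () ; C₀ = 0 ; x-col = λ ()
    ; y-col = λ () ; y-colorful = λ {i} → contradiction i ¬Fin0 }

  another : ∀ {M} → Fin (2 + M) → Fin (2 + M)
  another zero    = suc zero
  another (suc _) = zero

  another-≢ : ∀ {M} (i : Fin (2 + M)) → i ≢ another i
  another-≢ zero    ()
  another-≢ (suc _) ()

  -- A monochromatic subfamily of at least two candidates is a half-colourful
  -- matching: the colour of y_i differs from that of x_{another i}, which is
  -- the common colour C₀ of the x's.
  monochromatic-matching : ∀ {k M} (F : Candidates k) (e : Fin (2 + M) → Fin k) →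
    Injective _≡_ _≡_ e → (∀ i i' → col (Candidates.x F (e i)) ≡ col (Candidates.x F (e i'))) →
    HalfColorfulMatching H (2 + M)
  monochromatic-matching F e e-inj same-colour = record
    { x = x ∘ e ; y = y ∘ e ; edge = edge ∘ e
    ; x-inj = λ eq → e-inj (x-inj eq)
    ; y-inj = λ eq → e-inj (y-colorful (cong col eq))
    ; xy-disj = λ i j → xy-disj (e i) (e j)
    ; C₀ = col (x (e zero))
    ; x-col = λ i → same-colour i zero
    ; y-col = λ i eq → y-avoids-x (another-≢ i ∘ e-inj) (trans eq (same-colour zero (another i)))
    ; y-colorful = λ eq → e-inj (y-colorful eq) }
    where open Candidates F

  matching-from-candidates : ∀ {k c} (F : Candidates k) (cs : Fin c → ℕ) →
    (∀ j → Σ (Fin c) λ a → col (Candidates.x F j) ≡ cs a) →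
    Σ ℕ λ s → HalfColorfulMatching H s × k ≤ suc s * (c * c)
  matching-from-candidates {k} {c} F cs x-colour with monochromatic-subfamily (proj₁ ∘ x-colour)
  ... | 0 , _ , _ , _ , k≤c*M = 0 , emptyMatching , ≤-trans k≤c*M (scaled-bound c 0 z≤n)
  ... | 1 , _ , _ , _ , k≤c*M = 0 , emptyMatching , ≤-trans k≤c*M (scaled-bound c 0 ≤-refl)
  ... | suc (suc M) , e , e-inj , same-class , k≤c*M =
    2 + M , monochromatic-matching F e e-inj (λ i i' → class-colour (same-class i i')) ,
    ≤-trans k≤c*M (scaled-bound c (2 + M) (n≤1+n _))
    where
    open Candidates F
    class-colour : ∀ {j l} → proj₁ (x-colour j) ≡ proj₁ (x-colour l) → col (x j) ≡ col (x l)
    class-colour {j} {l} same =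
      trans (proj₂ (x-colour j)) (trans (cong cs same) (sym (proj₂ (x-colour l))))

module Separation {n : ℕ} {E : Fin n → Fin n → Set} (D : RootedTD n E) where
  open RootedTD D

  Desc-≤ : ∀ {a b} → Desc a b → toℕ b ≤ toℕ a
  Desc-≤ here       = ≤-refl
  Desc-≤ (up {i} d) = ≤-trans (Desc-≤ d) (≤-trans (par< i) (n≤1+n _))

  parent-not-below : ∀ i → ¬ Desc (par i) (suc i)
  parent-not-below i d = 1+n≰n (≤-trans (Desc-≤ d) (par< i))

  ancestors-comparable : ∀ {r a b} → Desc r a → Desc r b → Desc a b ⊎ Desc b a
  ancestors-comparable here     r↓b      = inj₁ r↓b
  ancestors-comparable (up r↓a) here     = inj₂ (up r↓a)
  ancestors-comparable (up r↓a) (up r↓b) = ancestors-comparable r↓a r↓b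

  sibling-below-sibling : ∀ {i i'} → par i ≡ par i' → Desc (suc i) (suc i') → i ≡ i'
  sibling-below-sibling _ here = refl
  sibling-below-sibling {i} {i'} same-parent (up d) =
    contradiction (≤-trans (Desc-≤ d) (subst (λ p → toℕ p ≤ toℕ i') (sym same-parent) (par< i')))
                  1+n≰n

  siblings-disjoint : ∀ {r i i'} → par i ≡ par i' → Desc r (suc i) → Desc r (suc i') → i ≡ i'
  siblings-disjoint same-parent r↓ r↓' with ancestors-comparable r↓ r↓'
  ... | inj₁ below = sibling-below-sibling same-parent below
  ... | inj₂ above = sym (sibling-below-sibling (sym same-parent) above)

  edge-from-subtree : ∀ {i a b} → Desc a (suc i) → TAdj a b → Desc b (suc i) ⊎ (a ≡ suc i × b ≡ par i)
  edge-from-subtree a↓ (inj₁ (j , refl , refl)) with a↓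
  ... | here   = inj₂ (refl , refl)
  ... | up b↓  = inj₁ b↓
  edge-from-subtree a↓ (inj₂ (j , refl , refl)) = inj₁ (up a↓)

  walk-start : ∀ {P a b} → WalkIn P a b → P a
  walk-start (stop Pa)     = Pa
  walk-start (step Pa _ _) = Pa

  walk-leaving-subtree : ∀ {P i a r} → WalkIn P a r → Desc a (suc i) → ¬ Desc r (suc i) →
                         P (suc i) × P (par i)
  walk-leaving-subtree (stop _) a↓ r↑ = contradiction a↓ r↑
  walk-leaving-subtree (step Pa a~b walk) a↓ r↑ with edge-from-subtree a↓ a~b
  ... | inj₁ b↓          = walk-leaving-subtree walk b↓ r↑
  ... | inj₂ (refl , refl) = Pa , walk-start walk

  adhesion-separates : ∀ {u i s r} → u ∈ β s → Desc s (suc i) → u ∈ β r → ¬ Desc r (suc i) →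
                       u ∈ σ (suc i)
  adhesion-separates {u} {s = s} {r} u∈s s↓ u∈r r↑ =
    x∈p∩q⁺ (walk-leaving-subtree (connected u s r u∈s u∈r) s↓ r↑)

  α-confined : ∀ {u i r} → u ∈α suc i → u ∈ β r → ¬ ¬ Desc r (suc i)
  α-confined ((s , s↓ , u∈s) , u∉σ) u∈r r↑ = u∉σ (adhesion-separates u∈s s↓ u∈r r↑)

  α-not-in-parent : ∀ {u i} → u ∈α suc i → u ∉ β (par i)
  α-not-in-parent {i = i} u∈α u∈par = α-confined u∈α u∈par (parent-not-below i)

  parent-meets-α : ∀ {u w i r} → u ∈α suc i → w ∈ β (par i) → u ∈ β r → w ∈ β r → w ∈ σ (suc i)
  parent-meets-α {w = w} {i} u∈α w∈par u∈r w∈r =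
    decidable-stable (w ∈? σ (suc i)) λ w∉σ →
      α-confined u∈α u∈r λ r↓ → w∉σ (adhesion-separates w∈r r↓ w∈par (parent-not-below i))

  α-siblings-apart : ∀ {u u' i i' r} → par i ≡ par i' → i ≢ i' →
                     u ∈α suc i → u' ∈α suc i' → u ∈ β r → u' ∈ β r → ⊥
  α-siblings-apart same-parent i≢i' u∈α u'∈α u∈r u'∈r =
    α-confined u∈α u∈r λ r↓ → α-confined u'∈α u'∈r λ r↓' →
      i≢i' (siblings-disjoint same-parent r↓ r↓')

module LambdaVertices (H : ColoredGraph) (D : GuardedCutvertexDecomposition H)
                      (t : GuardedCutvertexDecomposition.Node D) where
  open ColoredGraph H using (n; Adj; col)
  open GuardedCutvertexDecomposition D
  open Separation TD
  open MatchingCandidates H using (Candidates)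

  -- vertices of α of distinct siblings have distinct colours, as colour
  -- classes are cliques of H• and so would have to share a bag
  α-siblings-colours-differ : ∀ {u u' i i'} → par i ≡ par i' → i ≢ i' →
                              u ∈α suc i → u' ∈α suc i' → col u ≢ col u'
  α-siblings-colours-differ {u} {u'} same-parent i≢i' u∈α u'∈α same-colour with u ≟ᶠ u'
  ... | yes refl = α-siblings-apart same-parent i≢i' u∈α u'∈α u∈s u∈s
    where u∈s = proj₂ (proj₂ (proj₁ u∈α))
  ... | no u≢u' with covers-e u u' (inj₂ (u≢u' , same-colour))
  ...   | r , u∈r , u'∈r = α-siblings-apart same-parent i≢i' u∈α u'∈α u∈r u'∈r

  in-parent-bag : ∀ {i w} → ChildOf i t → w ∈ β t → w ∈ β (par i)
  in-parent-bag {w = w} i-child = subst (λ p → w ∈ β p) (sym i-child)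

  private-part-unique : ∀ {i v w} → ChildOf i t → v ∈ σ (suc i) ─ g t → w ∈ σ (suc i) ─ g t → v ≡ w
  private-part-unique {i} i-child = ≤1-members-equal (childCond t i i-child)

  child : ∀ {v} → v ∈λ t → Fin m
  child (_ , _ , i , _) = i

  is-child : ∀ {v} (v∈λ : v ∈λ t) → ChildOf (child v∈λ) t
  is-child (_ , _ , _ , i-child , _) = i-child

  partner : ∀ {v} → v ∈λ t → Fin n
  partner (_ , _ , _ , _ , u , _) = u

  partner-in-α : ∀ {v} (v∈λ : v ∈λ t) → partner v∈λ ∈α suc (child v∈λ)
  partner-in-α (_ , _ , _ , _ , _ , u∈α , _) = u∈α

  partner-adjacent : ∀ {v} (v∈λ : v ∈λ t) → Adj v (partner v∈λ)
  partner-adjacent (_ , _ , _ , _ , _ , _ , v~u) = v~u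

  in-private-part : ∀ {v} (v∈λ : v ∈λ t) → v ∈ σ (suc (child v∈λ)) ─ g t
  in-private-part v∈λ@(v∈t , v∉g , _) with covers-e _ _ (inj₁ (partner-adjacent v∈λ))
  ... | r , v∈r , u∈r =
    x∈p∧x∉q⇒x∈p─q (parent-meets-α (partner-in-α v∈λ) (in-parent-bag (is-child v∈λ) v∈t) u∈r v∈r) v∉g

  child-injective : ∀ {v w} (v∈λ : v ∈λ t) (w∈λ : w ∈λ t) → child v∈λ ≡ child w∈λ → v ≡ w
  child-injective {w = w} v∈λ w∈λ same-child =
    private-part-unique (is-child v∈λ) (in-private-part v∈λ)
      (subst (λ i → w ∈ σ (suc i) ─ g t) (sym same-child) (in-private-part w∈λ))

  partner-not-in-bag : ∀ {v w} (v∈λ : v ∈λ t) → w ∈ β t → partner v∈λ ≢ w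
  partner-not-in-bag v∈λ w∈t refl =
    α-not-in-parent (partner-in-α v∈λ) (in-parent-bag (is-child v∈λ) w∈t)

  -- a partner has the colour of no λ-vertex other than its own: a vertex of
  -- that colour in the bag of t would join the private part of its child
  partner-colour : ∀ {v w} (v∈λ : v ∈λ t) (w∈λ : w ∈λ t) → col (partner v∈λ) ≡ col w → v ≡ w
  partner-colour v∈λ w∈λ@(w∈t , w∉g , _) same-colour
    with covers-e _ _ (inj₂ (partner-not-in-bag v∈λ w∈t , same-colour))
  ... | r , u∈r , w∈r =
    private-part-unique (is-child v∈λ) (in-private-part v∈λ)
      (x∈p∧x∉q⇒x∈p─q (parent-meets-α (partner-in-α v∈λ) (in-parent-bag (is-child v∈λ) w∈t) u∈r w∈r) w∉g)

  partners-colourful : ∀ {v w} (v∈λ : v ∈λ t) (w∈λ : w ∈λ t) →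
                       col (partner v∈λ) ≡ col (partner w∈λ) → v ≡ w
  partners-colourful v∈λ w∈λ same-colour with child v∈λ ≟ᶠ child w∈λ
  ... | yes same-child = child-injective v∈λ w∈λ same-child
  ... | no other-child =
    contradiction same-colour
      (α-siblings-colours-differ (trans (is-child v∈λ) (sym (is-child w∈λ))) other-child
                                 (partner-in-α v∈λ) (partner-in-α w∈λ))

  λ-candidates : ∀ {k} (f : Fin k → Fin n) → Injective _≡_ _≡_ f → (∀ j → f j ∈λ t) → Candidates k
  λ-candidates f f-inj f∈λ = record
    { x = f
    ; y = λ j → partner (f∈λ j)
    ; edge = λ j → partner-adjacent (f∈λ j)
    ; x-inj = f-inj
    ; y-colorful = λ same → f-inj (partners-colourful (f∈λ _) (f∈λ _) same)
    ; xy-disj = λ j l eq → partner-not-in-bag (f∈λ l) (proj₁ (f∈λ j)) (sym eq)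
    ; y-avoids-x = λ j≢l same → j≢l (f-inj (partner-colour (f∈λ _) (f∈λ _) same))
    }

lemma6p13 : (H : ColoredGraph) (D : GuardedCutvertexDecomposition H) (c k : ℕ) →
    GuardedCutvertexDecomposition.GuardSize≤ D c →
    GuardedCutvertexDecomposition.BagColors≤ D c →
    (t : GuardedCutvertexDecomposition.Node D) →
    AtLeast k (λ v → GuardedCutvertexDecomposition._∈λ_ D v t) →
    Σ ℕ λ s → HalfColorfulMatching H s × k ≤ suc s * (c * c)
lemma6p13 H D c k _ bag-colours t (f , f-inj , f∈λ) =
  matching-from-candidates (λ-candidates f f-inj f∈λ) colours
    (λ j → colour-index (f j) (proj₁ (f∈λ j)))
  where
  open MatchingCandidates H using (matching-from-candidates)
  open LambdaVertices H D t using (λ-candidates)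
  colours : Fin c → ℕ
  colours = proj₁ (bag-colours t)
  colour-index : ∀ v → v ∈ GuardedCutvertexDecomposition.β D t →
                 Σ (Fin c) λ a → ColoredGraph.col H v ≡ colours a
  colour-index = proj₂ (bag-colours t)
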